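{- Let $H$ be a graph and let $t\geq s\geq 2$ be integers. If $G$ is a graph of order $n$ that is $H$-free and has no induced subgraph isomorphic to $K_{s,t}$, then \[ e(G)\leq \frac{1}{2}\left(R(H,K_t)\right)^{2/s}R(H,K_s)\, n^{2-1/s}. \]
   Context: All graphs are finite and simple; $e(G)$ is the number of edges of $G$. A graph is $H$-free if it contains no subgraph (not necessarily induced) isomorphic to $H$. For graphs $H$ and $F$, $R(H,F)$ is the smallest integer $N$ such that every graph on $N$ vertices contains a subgraph isomorphic to $H$ or its complement contains a subgraph isomorphic to $F$ (so $R(H,K_t)$ is the least $N$ such that every $N$-vertex graph contains a copy of $H$ or an independent set of size $t$). -}

module Defs where

open import Data.Nat using (ℕ; zero; suc; _+_; _*_; _^_; _≤_; _<_; _<ᵇ_)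
open import Data.Bool using (Bool; true; false; not; if_then_else_; _∧_)
open import Data.Fin using (Fin; toℕ; _≟_)
open import Data.Fin.Properties using (toℕ-injective)
open import Data.List using (List; map; allFin)
open import Data.Nat.ListAction using (sum)
open import Data.Product using (Σ; ∃; _×_; _,_)
open import Data.Sum using (_⊎_)
open import Relation.Nullary using (¬_; yes; no; contradiction)
open import Relation.Binary.PropositionalEquality using (_≡_; refl; sym)
open import Function.Definitions using (Injective)

record Graph (n : ℕ) : Set where
  field
    adj    : Fin n → Fin n → Bool
    adj-sym : ∀ i j → adj i j ≡ adj j i
    irrefl : ∀ i → adj i i ≡ false
open Graph public

edges : ∀ {n} → Graph n → ℕ
edges {n} G = sum (map (λ i → sum (map (λ j →
  if (toℕ i <ᵇ toℕ j) ∧ adj G i j then 1 else 0) (allFin n))) (allFin n))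

_⊆ᵍ_ : ∀ {h n} → Graph h → Graph n → Set
_⊆ᵍ_ {h} {n} H G = Σ (Fin h → Fin n) λ f →
  Injective _≡_ _≡_ f × (∀ u v → adj H u v ≡ true → adj G (f u) (f v) ≡ true)

_-free_ : ∀ {h n} → Graph h → Graph n → Set
H -free G = ¬ (H ⊆ᵍ G)

_⊆ᵢ_ : ∀ {h n} → Graph h → Graph n → Set
_⊆ᵢ_ {h} {n} F G = Σ (Fin h → Fin n) λ f →
  Injective _≡_ _≡_ f × (∀ u v → adj G (f u) (f v) ≡ adj F u v)

private
  cadj : ∀ {n} → Graph n → Fin n → Fin n → Bool
  cadj G i j with i ≟ j
  ... | yes _ = false
  ... | no  _ = not (adj G i j)

  csym : ∀ {n} (G : Graph n) i j → cadj G i j ≡ cadj G j i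
  csym G i j with i ≟ j | j ≟ i
  ... | yes _ | yes _ = refl
  ... | yes p | no q = contradiction (sym p) q
  ... | no p | yes q = contradiction (sym q) p
  ... | no _ | no _ rewrite Graph.adj-sym G i j = refl

  cirr : ∀ {n} (G : Graph n) i → cadj G i i ≡ false
  cirr G i with i ≟ i
  ... | yes _ = refl
  ... | no p = contradiction refl p

complement : ∀ {n} → Graph n → Graph n
complement G = record { adj = cadj G ; adj-sym = csym G ; irrefl = cirr G }

private
  kadj : ∀ {t} → Fin t → Fin t → Bool
  kadj i j with i ≟ j
  ... | yes _ = false
  ... | no  _ = true

  ksym : ∀ {t} (i j : Fin t) → kadj i j ≡ kadj j i
  ksym i j with i ≟ j | j ≟ i
  ... | yes _ | yes _ = refl
  ... | yes p | no q = contradiction (sym p) q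
  ... | no p | yes q = contradiction (sym q) p
  ... | no _ | no _ = refl

  kirr : ∀ {t} (i : Fin t) → kadj i i ≡ false
  kirr i with i ≟ i
  ... | yes _ = refl
  ... | no p = contradiction refl p

K : (t : ℕ) → Graph t
K t = record { adj = kadj ; adj-sym = ksym ; irrefl = kirr }

private
  side : ∀ {s t} → Fin (s + t) → Bool
  side {s} i = toℕ i <ᵇ s

  xor : Bool → Bool → Bool
  xor true b = not b
  xor false b = b

  xor-comm : ∀ a b → xor a b ≡ xor b a
  xor-comm true true = refl
  xor-comm true false = refl
  xor-comm false true = refl
  xor-comm false false = refl

  xor-self : ∀ a → xor a a ≡ false
  xor-self true = refl
  xor-self false = refl

Kbip : (s t : ℕ) → Graph (s + t)
Kbip s t = record
  { adj = λ i j → xor (side {s} {t} i) (side {s} {t} j)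
  ; adj-sym = λ i j → xor-comm (side {s} {t} i) (side {s} {t} j)
  ; irrefl = λ i → xor-self (side {s} {t} i) }

RamseyProp : ∀ {h f} → Graph h → Graph f → ℕ → Set
RamseyProp H F N = (G : Graph N) → (H ⊆ᵍ G) ⊎ (F ⊆ᵍ complement G)

IsRamseyNumber : ∀ {h f} → Graph h → Graph f → ℕ → Set
IsRamseyNumber H F N = RamseyProp H F N × (∀ M → RamseyProp H F M → N ≤ M)

module Submission where

-- Let G be an H-free graph on n vertices with no induced K_{s,t} (2 ≤ s ≤ t), and write
-- Rs = R(H,K_s), Rt = R(H,K_t).  Since G is H-free, every vertex set of size ≥ R(H,K_k)
-- contains an independent k-set.  Two consequences drive the proof:
--  * supersaturation: a vertex set U with |U| ≥ Rs contains at least |U|ˢ/Rsˢ independent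
--    s-tuples (induction on |U|, double counting the tuples of U ─ w over w ∈ U);
--  * an independent s-tuple has fewer than Rt common neighbours, since an independent
--    t-tuple among them would span an induced K_{s,t}.
-- Applying the first to each neighbourhood and the second to each tuple gives
-- ∑_v deg(v)ˢ ≤ Rsˢ (∑_v #indep_s(N(v)) + n) ≤ Rsˢ Rt nˢ, and the handshake lemma with the
-- power-mean inequality turns this into (2e)ˢ ≤ nˢ⁻¹ ∑_v deg(v)ˢ ≤ Rt² Rsˢ n²ˢ⁻¹.

open import Defs
open import Data.Nat
open import Data.Nat.Properties
open import Data.Nat.Solver using (module +-*-Solver)
open import Data.Fin using (Fin; zero; suc; toℕ; inject≤; _↑ˡ_; _↑ʳ_; splitAt)
open import Data.Fin.Properties
  using (¬Fin0; toℕ-injective; inject≤-injective; toℕ-↑ˡ; toℕ-↑ʳ; toℕ<n; splitAt-↑ˡ; splitAt-↑ʳ; join-splitAt)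
  renaming (_≟_ to _≟ᶠ_; suc-injective to suc-injectiveᶠ)
open import Data.Bool using (Bool; true; false; _∧_; not; if_then_else_)
open import Data.Bool.Properties using (∧-identityʳ; ∧-zeroʳ; ∧-assoc; ∧-conicalˡ; ∧-conicalʳ; T-≡; ¬-not)
open import Data.Vec using (Vec; []; _∷_; lookup; tabulate)
import Data.List as List
open import Data.Nat.ListAction using () renaming (sum to listSum)
open import Data.Product using (Σ; _×_; _,_)
open import Data.Sum using (_⊎_; inj₁; inj₂; [_,_]′)
open import Data.Empty using (⊥-elim)
open import Function using (_∘_; Equivalence)
open import Function.Definitions using (Injective)
open import Relation.Nullary using (¬_; yes; no; does)
open import Relation.Nullary.Decidable using (dec-false)
open import Relation.Binary using (tri<; tri≈; tri>)
open import Relation.Binary.PropositionalEquality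
open import Algebra.Properties.Semiring.Sum +-*-semiring
  using (sum; sum-syntax; sum-cong-≗; ∑-distrib-+; ∑-comm; *-distribˡ-sum; *-distribʳ-sum)

open import Algebra.Properties.CommutativeSemigroup *-commutativeSemigroup
  using () renaming (x∙yz≈y∙xz to x*[y*z]≡y*[x*z])

open +-*-Solver using (solve; _:+_; _:*_; _:=_; con)

∑-mono : ∀ {n} {f g : Fin n → ℕ} → (∀ i → f i ≤ g i) → sum f ≤ sum g
∑-mono {zero}  f≤g = z≤n
∑-mono {suc n} f≤g = +-mono-≤ (f≤g zero) (∑-mono (f≤g ∘ suc))

∑-const : ∀ n c → ∑[ i < n ] c ≡ n * c
∑-const zero    c = refl
∑-const (suc n) c = cong (c +_) (∑-const n c)

term≤∑ : ∀ {n} (f : Fin n → ℕ) i → f i ≤ sum f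
term≤∑ f zero    = m≤m+n _ _
term≤∑ f (suc i) = ≤-trans (term≤∑ (f ∘ suc) i) (m≤n+m _ _)

∑ᵗ : ∀ {n} s → (Vec (Fin n) s → ℕ) → ℕ
∑ᵗ zero          F = F []
∑ᵗ {n} (suc s) F = ∑[ a < n ] ∑ᵗ s (λ xs → F (a ∷ xs))

∑ᵗ-cong : ∀ {n} s {F G : Vec (Fin n) s → ℕ} → (∀ xs → F xs ≡ G xs) → ∑ᵗ s F ≡ ∑ᵗ s G
∑ᵗ-cong zero    F≡G = F≡G []
∑ᵗ-cong (suc s) F≡G = sum-cong-≗ (λ a → ∑ᵗ-cong s (λ xs → F≡G (a ∷ xs)))

∑ᵗ-mono : ∀ {n} s {F G : Vec (Fin n) s → ℕ} → (∀ xs → F xs ≤ G xs) → ∑ᵗ s F ≤ ∑ᵗ s G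
∑ᵗ-mono zero    F≤G = F≤G []
∑ᵗ-mono (suc s) F≤G = ∑-mono (λ a → ∑ᵗ-mono s (λ xs → F≤G (a ∷ xs)))

∑ᵗ-distrib-+ : ∀ {n} s (F G : Vec (Fin n) s → ℕ) → ∑ᵗ s (λ xs → F xs + G xs) ≡ ∑ᵗ s F + ∑ᵗ s G
∑ᵗ-distrib-+ zero    F G = refl
∑ᵗ-distrib-+ (suc s) F G =
  trans (sum-cong-≗ (λ a → ∑ᵗ-distrib-+ s (λ xs → F (a ∷ xs)) (λ xs → G (a ∷ xs))))
        (∑-distrib-+ (λ a → ∑ᵗ s (λ xs → F (a ∷ xs))) (λ a → ∑ᵗ s (λ xs → G (a ∷ xs))))

∑ᵗ-distribˡ : ∀ {n} s c (F : Vec (Fin n) s → ℕ) → c * ∑ᵗ s F ≡ ∑ᵗ s (λ xs → c * F xs)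
∑ᵗ-distribˡ zero    c F = refl
∑ᵗ-distribˡ (suc s) c F =
  trans (*-distribˡ-sum c (λ a → ∑ᵗ s (λ xs → F (a ∷ xs))))
        (sum-cong-≗ (λ a → ∑ᵗ-distribˡ s c (λ xs → F (a ∷ xs))))

∑ᵗ-const : ∀ {n} s c → ∑ᵗ {n} s (λ _ → c) ≡ n ^ s * c
∑ᵗ-const      zero    c = sym (+-identityʳ c)
∑ᵗ-const {n} (suc s) c = begin
  ∑[ a < n ] ∑ᵗ {n} s (λ _ → c)  ≡⟨ sum-cong-≗ {n} (λ _ → ∑ᵗ-const {n} s c) ⟩
  ∑[ a < n ] (n ^ s * c)         ≡⟨ ∑-const n _ ⟩
  n * (n ^ s * c)                ≡⟨ *-assoc n (n ^ s) c ⟨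
  n ^ suc s * c                  ∎
  where open ≡-Reasoning

∑-∑ᵗ-comm : ∀ {n} m s (F : Fin m → Vec (Fin n) s → ℕ) →
  ∑[ v < m ] ∑ᵗ s (F v) ≡ ∑ᵗ s (λ xs → ∑[ v < m ] F v xs)
∑-∑ᵗ-comm m zero    F = refl
∑-∑ᵗ-comm m (suc s) F =
  trans (∑-comm (λ v a → ∑ᵗ s (λ xs → F v (a ∷ xs))))
        (sum-cong-≗ (λ a → ∑-∑ᵗ-comm m s (λ v xs → F v (a ∷ xs))))

term≤∑ᵗ : ∀ {n} s (F : Vec (Fin n) s → ℕ) xs → F xs ≤ ∑ᵗ s F
term≤∑ᵗ zero    F []       = ≤-refl
term≤∑ᵗ (suc s) F (a ∷ xs) =
  ≤-trans (term≤∑ᵗ s (λ ys → F (a ∷ ys)) xs) (term≤∑ (λ b → ∑ᵗ s (λ ys → F (b ∷ ys))) a)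

ind : Bool → ℕ
ind b = if b then 1 else 0

count : ∀ {n} → (Fin n → Bool) → ℕ
count {n} U = ∑[ i < n ] ind (U i)

count-cong : ∀ {n} {U V : Fin n → Bool} → (∀ i → U i ≡ V i) → count U ≡ count V
count-cong U≡V = sum-cong-≗ (cong ind ∘ U≡V)

element : ∀ {n} (U : Fin n → Bool) m → count U ≡ suc m → Σ (Fin n) λ w → U w ≡ true
element {suc n} U m ∣U∣≡1+m with U zero in U₀
... | true  = zero , U₀
... | false with element (U ∘ suc) m ∣U∣≡1+m
...   | w , Uw = suc w , Uw

_==_ : ∀ {n} → Fin n → Fin n → Bool
a == b = does (a ≟ᶠ b)

_─_ : ∀ {n} → (Fin n → Bool) → Fin n → Fin n → Bool
(U ─ a) z = U z ∧ not (z == a)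

count-─ : ∀ {n} (U : Fin n → Bool) a → U a ≡ true → count (U ─ a) + 1 ≡ count U
count-─ {suc n} U zero Ua rewrite Ua =
  trans (+-comm (count (λ i → U (suc i) ∧ true)) 1)
        (cong suc (count-cong (λ i → ∧-identityʳ (U (suc i)))))
count-─ {suc n} U (suc a) Ua rewrite ∧-identityʳ (U zero) =
  trans (+-assoc (ind (U zero)) _ 1) (cong (ind (U zero) +_) (count-─ (U ∘ suc) a Ua))

rearrangement : ∀ {x y p q} → x ≤ y → p ≤ q → x * q + y * p ≤ x * p + y * q
rearrangement {x} {p = p} x≤y p≤q with m≤n⇒∃[o]m+o≡n x≤y | m≤n⇒∃[o]m+o≡n p≤q
... | d , refl | e , refl = ≤-trans (m≤m+n _ (d * e)) (≤-reflexive (solve 4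
  (λ x p d e → x :* (p :+ e) :+ (x :+ d) :* p :+ d :* e := x :* p :+ (x :+ d) :* (p :+ e))
  refl x p d e))

pow-rearrangement : ∀ x y k → x * y ^ k + y * x ^ k ≤ x * x ^ k + y * y ^ k
pow-rearrangement x y k with ≤-total x y
... | inj₁ x≤y = rearrangement x≤y (^-monoˡ-≤ k x≤y)
... | inj₂ y≤x = subst₂ _≤_ (+-comm (y * x ^ k) _) (+-comm (y * y ^ k) _)
                        (rearrangement y≤x (^-monoˡ-≤ k y≤x))

∑∑-symmetrise : ∀ {n} (f : Fin n → Fin n → ℕ) →
  ∑[ i < n ] ∑[ j < n ] (f i j + f j i) ≡ 2 * ∑[ i < n ] ∑[ j < n ] f i j
∑∑-symmetrise {n} f = begin
  ∑[ i < n ] ∑[ j < n ] (f i j + f j i)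
    ≡⟨ sum-cong-≗ (λ i → ∑-distrib-+ (f i) (λ j → f j i)) ⟩
  ∑[ i < n ] (∑[ j < n ] f i j + ∑[ j < n ] f j i)
    ≡⟨ ∑-distrib-+ (λ i → sum (f i)) (λ i → ∑[ j < n ] f j i) ⟩
  S + ∑[ i < n ] ∑[ j < n ] f j i
    ≡⟨ cong (S +_) (∑-comm (λ j i → f j i)) ⟨
  S + S
    ≡⟨ cong (S +_) (+-identityʳ S) ⟨
  2 * S ∎
  where
  open ≡-Reasoning
  S : ℕ
  S = ∑[ i < n ] ∑[ j < n ] f i j

∑∑-product : ∀ {n} (f g : Fin n → ℕ) → ∑[ i < n ] ∑[ j < n ] (f i * g j) ≡ sum f * sum g
∑∑-product f g = trans (sum-cong-≗ (λ i → sym (*-distribˡ-sum (f i) g))) (sym (*-distribʳ-sum (sum g) f))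

chebyshev : ∀ n (a : Fin n → ℕ) k → sum a * ∑[ i < n ] (a i ^ k) ≤ n * ∑[ i < n ] (a i ^ suc k)
chebyshev n a k = *-cancelˡ-≤ 2 (begin
  2 * (sum a * ∑[ i < n ] (a i ^ k))
    ≡⟨ cong (2 *_) (∑∑-product a (λ j → a j ^ k)) ⟨
  2 * ∑[ i < n ] ∑[ j < n ] (a i * a j ^ k)
    ≡⟨ ∑∑-symmetrise (λ i j → a i * a j ^ k) ⟨
  ∑[ i < n ] ∑[ j < n ] (a i * a j ^ k + a j * a i ^ k)
    ≤⟨ ∑-mono (λ i → ∑-mono (λ j → pow-rearrangement (a i) (a j) k)) ⟩
  ∑[ i < n ] ∑[ j < n ] (a i ^ suc k + a j ^ suc k)
    ≡⟨ ∑∑-symmetrise (λ i j → a i ^ suc k) ⟩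
  2 * ∑[ i < n ] ∑[ j < n ] (a i ^ suc k)
    ≡⟨ cong (2 *_) (sum-cong-≗ (λ i → ∑-const n (a i ^ suc k))) ⟩
  2 * ∑[ i < n ] (n * a i ^ suc k)
    ≡⟨ cong (2 *_) (*-distribˡ-sum n (λ i → a i ^ suc k)) ⟨
  2 * (n * ∑[ i < n ] (a i ^ suc k)) ∎)
  where open ≤-Reasoning

power-mean : ∀ n (a : Fin n → ℕ) k → sum a ^ suc k ≤ n ^ k * ∑[ i < n ] (a i ^ suc k)
power-mean n a zero = begin
  sum a * 1                  ≡⟨ *-identityʳ (sum a) ⟩
  sum a                      ≡⟨ sum-cong-≗ (λ i → *-identityʳ (a i)) ⟨
  ∑[ i < n ] (a i ^ 1)       ≡⟨ +-identityʳ _ ⟨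
  1 * ∑[ i < n ] (a i ^ 1)   ∎
  where open ≤-Reasoning
power-mean n a (suc k) = begin
  sum a * sum a ^ suc k                           ≤⟨ *-monoʳ-≤ (sum a) (power-mean n a k) ⟩
  sum a * (n ^ k * ∑[ i < n ] (a i ^ suc k))      ≡⟨ x*[y*z]≡y*[x*z] (sum a) (n ^ k) _ ⟩
  n ^ k * (sum a * ∑[ i < n ] (a i ^ suc k))      ≤⟨ *-monoʳ-≤ (n ^ k) (chebyshev n a (suc k)) ⟩
  n ^ k * (n * ∑[ i < n ] (a i ^ suc (suc k)))    ≡⟨ x*[y*z]≡y*[x*z] (n ^ k) n _ ⟩
  n * (n ^ k * ∑[ i < n ] (a i ^ suc (suc k)))    ≡⟨ *-assoc n (n ^ k) _ ⟨
  n ^ suc k * ∑[ i < n ] (a i ^ suc (suc k))      ∎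
  where open ≤-Reasoning

bernoulli : ∀ p s → (p ∸ s) * p ^ s ≤ p * (p ∸ 1) ^ s
bernoulli p zero    = ≤-refl
bernoulli p (suc s) = begin
  (p ∸ suc s) * (p * p ^ s)      ≡⟨ *-assoc (p ∸ suc s) p _ ⟨
  (p ∸ suc s) * p * p ^ s        ≤⟨ *-monoˡ-≤ (p ^ s) (one-step p s) ⟩
  (p ∸ 1) * (p ∸ s) * p ^ s      ≡⟨ *-assoc (p ∸ 1) _ _ ⟩
  (p ∸ 1) * ((p ∸ s) * p ^ s)    ≤⟨ *-monoʳ-≤ (p ∸ 1) (bernoulli p s) ⟩
  (p ∸ 1) * (p * (p ∸ 1) ^ s)    ≡⟨ x*[y*z]≡y*[x*z] (p ∸ 1) p _ ⟩
  p * ((p ∸ 1) * (p ∸ 1) ^ s)    ∎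
  where
  open ≤-Reasoning
  1+[s+r]∸s≡1+r : ∀ s r → suc (s + r) ∸ s ≡ suc r
  1+[s+r]∸s≡1+r s r = trans (cong (_∸ s) (sym (+-suc s r))) (m+n∸m≡n s (suc r))
  -- (p - s - 1) p ≤ (p - 1)(p - s): the two sides differ by s when p > s.
  one-step : ∀ p s → (p ∸ suc s) * p ≤ (p ∸ 1) * (p ∸ s)
  one-step p s with s <? p
  ... | no  s≮p rewrite m≤n⇒m∸n≡0 (m≤n⇒m≤1+n (≮⇒≥ s≮p)) = z≤n
  ... | yes s<p with m≤n⇒∃[o]m+o≡n s<p
  ...   | r , refl rewrite m+n∸m≡n s r | 1+[s+r]∸s≡1+r s r =
    ≤-trans (m≤m+n _ s) (≤-reflexive (solve 2
      (λ s r → r :* (con 1 :+ (s :+ r)) :+ s := (s :+ r) :* (con 1 :+ r)) refl s r))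

<ᵇ-true : ∀ {a b} → a < b → (a <ᵇ b) ≡ true
<ᵇ-true a<b = Equivalence.to T-≡ (<⇒<ᵇ a<b)

<ᵇ-false : ∀ {a b} → ¬ a < b → (a <ᵇ b) ≡ false
<ᵇ-false {a} {b} a≮b = ¬-not (a≮b ∘ <ᵇ⇒< a b ∘ Equivalence.from T-≡)

degree : ∀ {n} → Graph n → Fin n → ℕ
degree G v = count (adj G v)

listSum-tabulate : ∀ {A : Set} n (f : A → ℕ) (g : Fin n → A) →
  listSum (List.map f (List.tabulate g)) ≡ ∑[ i < n ] f (g i)
listSum-tabulate zero    f g = refl
listSum-tabulate (suc n) f g = cong (f (g zero) +_) (listSum-tabulate n f (g ∘ suc))

edges-as-∑ : ∀ {n} (G : Graph n) →
  edges G ≡ ∑[ i < n ] ∑[ j < n ] ind ((toℕ i <ᵇ toℕ j) ∧ adj G i j)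
edges-as-∑ {n} G = trans (listSum-tabulate n _ (λ i → i))
  (sum-cong-≗ (λ i → listSum-tabulate n (λ j → ind ((toℕ i <ᵇ toℕ j) ∧ adj G i j)) (λ j → j)))

adj-split : ∀ {n} (G : Graph n) i j →
  ind (adj G i j) ≡ ind ((toℕ i <ᵇ toℕ j) ∧ adj G i j) + ind ((toℕ j <ᵇ toℕ i) ∧ adj G j i)
adj-split G i j with <-cmp (toℕ i) (toℕ j)
... | tri< i<j _ j≮i rewrite <ᵇ-true i<j | <ᵇ-false j≮i = sym (+-identityʳ _)
... | tri> i≮j _ j<i rewrite <ᵇ-false i≮j | <ᵇ-true j<i | adj-sym G i j = refl
... | tri≈ i≮j i≡j j≮i rewrite <ᵇ-false i≮j | <ᵇ-false j≮i | toℕ-injective i≡j | irrefl G j = refl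

handshake : ∀ {n} (G : Graph n) → ∑[ v < n ] degree G v ≡ 2 * edges G
handshake {n} G = begin
  ∑[ i < n ] ∑[ j < n ] ind (adj G i j)        ≡⟨ sum-cong-≗ (λ i → sum-cong-≗ (adj-split G i)) ⟩
  ∑[ i < n ] ∑[ j < n ] (f i j + f j i)        ≡⟨ ∑∑-symmetrise f ⟩
  2 * ∑[ i < n ] ∑[ j < n ] f i j              ≡⟨ cong (2 *_) (edges-as-∑ G) ⟨
  2 * edges G                                  ∎
  where
  open ≡-Reasoning
  f : Fin n → Fin n → ℕ
  f i j = ind ((toℕ i <ᵇ toℕ j) ∧ adj G i j)

allᵇ : ∀ {A : Set} {k} → (A → Bool) → Vec A k → Bool
allᵇ p []       = true
allᵇ p (a ∷ xs) = p a ∧ allᵇ p xs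

allᵇ-lookup : ∀ {A : Set} {k} (p : A → Bool) (xs : Vec A k) → allᵇ p xs ≡ true →
  ∀ i → p (lookup xs i) ≡ true
allᵇ-lookup p (a ∷ xs) all zero    = ∧-conicalˡ (p a) _ all
allᵇ-lookup p (a ∷ xs) all (suc i) = allᵇ-lookup p xs (∧-conicalʳ (p a) _ all) i

allᵇ-tabulate : ∀ {A : Set} {k} (p : A → Bool) (g : Fin k → A) → (∀ i → p (g i) ≡ true) →
  allᵇ p (tabulate g) ≡ true
allᵇ-tabulate {k = zero}  p g pg = refl
allᵇ-tabulate {k = suc k} p g pg = cong₂ _∧_ (pg zero) (allᵇ-tabulate p (g ∘ suc) (pg ∘ suc))

allᵇ-∧ : ∀ {A : Set} {k} (p q : A → Bool) (xs : Vec A k) → allᵇ p xs ≡ true → allᵇ q xs ≡ true →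
  allᵇ (λ z → p z ∧ q z) xs ≡ true
allᵇ-∧ p q []       _ _ = refl
allᵇ-∧ p q (a ∷ xs) all-p all-q = cong₂ _∧_
  (cong₂ _∧_ (∧-conicalˡ (p a) _ all-p) (∧-conicalˡ (q a) _ all-q))
  (allᵇ-∧ p q xs (∧-conicalʳ (p a) _ all-p) (∧-conicalʳ (q a) _ all-q))

allᵇ-mono : ∀ {A : Set} {k} {p q : A → Bool} (xs : Vec A k) → (∀ z → p z ≡ true → q z ≡ true) →
  allᵇ p xs ≡ true → allᵇ q xs ≡ true
allᵇ-mono []       p⇒q _   = refl
allᵇ-mono (a ∷ xs) p⇒q all = cong₂ _∧_ (p⇒q a (∧-conicalˡ _ _ all)) (allᵇ-mono xs p⇒q (∧-conicalʳ _ _ all))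

isClique : ∀ {n k} → Graph n → Vec (Fin n) k → Bool
isClique G []       = true
isClique G (a ∷ xs) = allᵇ (adj G a) xs ∧ isClique G xs

isIndependent : ∀ {n k} → Graph n → Vec (Fin n) k → Bool
isIndependent G = isClique (complement G)

adjacent⇒distinct : ∀ {n} (G : Graph n) {a b} → adj G a b ≡ true → a ≢ b
adjacent⇒distinct G {a} ab refl with () ← trans (sym ab) (irrefl G a)

clique-lookup : ∀ {n k} (G : Graph n) (xs : Vec (Fin n) k) → isClique G xs ≡ true →
  ∀ i j → i ≢ j → adj G (lookup xs i) (lookup xs j) ≡ true
clique-lookup G (a ∷ xs) cl zero    zero    i≢j = ⊥-elim (i≢j refl)
clique-lookup G (a ∷ xs) cl zero    (suc j) _   = allᵇ-lookup (adj G a) xs (∧-conicalˡ _ _ cl) j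
clique-lookup G (a ∷ xs) cl (suc i) zero    _   =
  trans (adj-sym G _ a) (allᵇ-lookup (adj G a) xs (∧-conicalˡ _ _ cl) i)
clique-lookup G (a ∷ xs) cl (suc i) (suc j) i≢j =
  clique-lookup G xs (∧-conicalʳ _ _ cl) i j (i≢j ∘ cong suc)

clique-tabulate : ∀ {n k} (G : Graph n) (f : Fin k → Fin n) →
  (∀ u v → u ≢ v → adj G (f u) (f v) ≡ true) → isClique G (tabulate f) ≡ true
clique-tabulate {k = zero}  G f f-adj = refl
clique-tabulate {k = suc k} G f f-adj = cong₂ _∧_
  (allᵇ-tabulate (adj G (f zero)) (f ∘ suc) (λ i → f-adj zero (suc i) (λ ())))
  (clique-tabulate G (f ∘ suc) (λ u v u≢v → f-adj (suc u) (suc v) (u≢v ∘ suc-injectiveᶠ)))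

complement-adj : ∀ {n} (G : Graph n) a b → adj (complement G) a b ≡ true → adj G a b ≡ false
complement-adj G a b ab with a ≟ᶠ b
complement-adj G a b () | yes _
complement-adj G a b ab | no  _ with adj G a b
complement-adj G a b () | no  _ | true
complement-adj G a b ab | no  _ | false = refl

independent-nonadjacent : ∀ {n k} (G : Graph n) (xs : Vec (Fin n) k) → isIndependent G xs ≡ true →
  ∀ u v → adj G (lookup xs u) (lookup xs v) ≡ false
independent-nonadjacent G xs ind-xs u v with u ≟ᶠ v
... | yes refl = irrefl G _
... | no  u≢v  = complement-adj G _ _ (clique-lookup (complement G) xs ind-xs u v u≢v)

independent-injective : ∀ {n k} (G : Graph n) (xs : Vec (Fin n) k) → isIndependent G xs ≡ true →
  Injective _≡_ _≡_ (lookup xs)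
independent-injective G xs ind-xs {u} {v} xu≡xv with u ≟ᶠ v
... | yes u≡v = u≡v
... | no  u≢v = ⊥-elim (adjacent⇒distinct (complement G) (clique-lookup (complement G) xs ind-xs u v u≢v) xu≡xv)

==-sym : ∀ {n} (a b : Fin n) → (a == b) ≡ (b == a)
==-sym a b with a ≟ᶠ b | b ≟ᶠ a
... | yes _    | yes _    = refl
... | no  _    | no  _    = refl
... | yes a≡b  | no  b≢a  = ⊥-elim (b≢a (sym a≡b))
... | no  a≢b  | yes b≡a  = ⊥-elim (a≢b (sym b≡a))

_∉ᵇ_ : ∀ {n k} → Fin n → Vec (Fin n) k → Bool
w ∉ᵇ xs = allᵇ (λ z → not (w == z)) xs

-- A clique xs lying inside U has k distinct elements, so U outside xs has |U| - k elements.
count-outside : ∀ {n k} (G : Graph n) (xs : Vec (Fin n) k) (U : Fin n → Bool) →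
  isClique G xs ≡ true → allᵇ U xs ≡ true → count (λ w → U w ∧ w ∉ᵇ xs) + k ≡ count U
count-outside G [] U _ _ = trans (+-identityʳ _) (count-cong (λ w → ∧-identityʳ (U w)))
count-outside {k = suc k} G (x ∷ ys) U cl xs⊆U = begin
  count (λ w → U w ∧ (not (w == x) ∧ w ∉ᵇ ys)) + suc k  ≡⟨ cong (_+ suc k) (count-cong (λ w → ∧-assoc (U w) _ _)) ⟨
  count (λ w → (U ─ x) w ∧ w ∉ᵇ ys) + suc k            ≡⟨ +-suc _ k ⟩
  suc (count (λ w → (U ─ x) w ∧ w ∉ᵇ ys) + k)          ≡⟨ cong suc (count-outside G ys (U ─ x) (∧-conicalʳ _ _ cl) ys⊆U─x) ⟩
  suc (count (U ─ x))                                  ≡⟨ +-comm 1 _ ⟩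
  count (U ─ x) + 1                                    ≡⟨ count-─ U x (∧-conicalˡ _ _ xs⊆U) ⟩
  count U                                              ∎
  where
  open ≡-Reasoning
  neighbour≢x : ∀ z → adj G x z ≡ true → not (z == x) ≡ true
  neighbour≢x z xz = cong not (dec-false (z ≟ᶠ x) (adjacent⇒distinct G xz ∘ sym))
  ys⊆U─x : allᵇ (U ─ x) ys ≡ true
  ys⊆U─x = allᵇ-∧ U (λ z → not (z == x)) ys (∧-conicalʳ _ _ xs⊆U)
             (allᵇ-mono ys neighbour≢x (∧-conicalˡ _ _ cl))

allᵇ-─ : ∀ {n k} (U : Fin n → Bool) w (xs : Vec (Fin n) k) → allᵇ (U ─ w) xs ≡ allᵇ U xs ∧ w ∉ᵇ xs
allᵇ-─ U w []       = refl
allᵇ-─ U w (a ∷ xs) rewrite allᵇ-─ U w xs | ==-sym a w =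
  interchange (U a) (not (w == a)) (allᵇ U xs) (w ∉ᵇ xs)
  where
  interchange : ∀ p q r s → (p ∧ q) ∧ (r ∧ s) ≡ (p ∧ r) ∧ (q ∧ s)
  interchange true  true  r s = refl
  interchange true  false r s = sym (∧-zeroʳ r)
  interchange false q     r s = refl

induced : ∀ {n m} → Graph n → (Fin m → Fin n) → Graph m
induced G f = record
  { adj = λ i j → adj G (f i) (f j)
  ; adj-sym = λ i j → adj-sym G (f i) (f j)
  ; irrefl = λ i → irrefl G (f i) }

complement-induced : ∀ {n m} (G : Graph n) (f : Fin m → Fin n) → Injective _≡_ _≡_ f →
  ∀ i j → adj (complement (induced G f)) i j ≡ adj (complement G) (f i) (f j)
complement-induced G f f-inj i j with i ≟ᶠ j | f i ≟ᶠ f j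
... | yes _   | yes _     = refl
... | no  _   | no  _     = refl
... | yes i≡j | no  fi≢fj = ⊥-elim (fi≢fj (cong f i≡j))
... | no  i≢j | yes fi≡fj = ⊥-elim (i≢j (f-inj fi≡fj))

K-adj : ∀ {t} {u v : Fin t} → u ≢ v → adj (K t) u v ≡ true
K-adj {u = u} {v} u≢v with u ≟ᶠ v
... | yes u≡v = ⊥-elim (u≢v u≡v)
... | no  _   = refl

enumerate : ∀ {n} (U : Fin n → Bool) →
  Σ (Fin (count U) → Fin n) λ e → Injective _≡_ _≡_ e × (∀ i → U (e i) ≡ true)
enumerate {zero} U = (λ ()) , (λ {}) , (λ ())
enumerate {suc n} U with U zero in U₀ | enumerate (U ∘ suc)
... | false | e , e-inj , e∈U = suc ∘ e , e-inj ∘ suc-injectiveᶠ , e∈U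
... | true  | e , e-inj , e∈U = e′ , e′-inj , e′∈U
  where
  e′ : Fin (suc (count (U ∘ suc))) → Fin (suc n)
  e′ zero    = zero
  e′ (suc i) = suc (e i)
  e′-inj : Injective _≡_ _≡_ e′
  e′-inj {zero}  {zero}  _ = refl
  e′-inj {suc i} {suc j} e′i≡e′j = cong suc (e-inj (suc-injectiveᶠ e′i≡e′j))
  e′∈U : ∀ i → U (e′ i) ≡ true
  e′∈U zero    = U₀
  e′∈U (suc i) = e∈U i

embed-into : ∀ {n N} (U : Fin n → Bool) → N ≤ count U →
  Σ (Fin N → Fin n) λ ι → Injective _≡_ _≡_ ι × (∀ i → U (ι i) ≡ true)
embed-into U N≤∣U∣ with enumerate U
... | e , e-inj , e∈U =
  e ∘ (λ i → inject≤ i N≤∣U∣) , inject≤-injective N≤∣U∣ N≤∣U∣ _ _ ∘ e-inj , e∈U ∘ _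

ramsey-within : ∀ {h f n N} (H : Graph h) (F : Graph f) (G : Graph n) → RamseyProp H F N →
  (U : Fin n → Bool) → N ≤ count U →
  (H ⊆ᵍ G) ⊎ (Σ (Fin f → Fin n) λ g →
    (∀ u v → adj F u v ≡ true → adj (complement G) (g u) (g v) ≡ true) × (∀ u → U (g u) ≡ true))
ramsey-within H F G ramsey U N≤∣U∣ with embed-into U N≤∣U∣
... | ι , ι-inj , ι∈U with ramsey (induced G ι)
...   | inj₁ (φ , φ-inj , φ-hom) = inj₁ (ι ∘ φ , φ-inj ∘ ι-inj , φ-hom)
...   | inj₂ (φ , _ , φ-hom) = inj₂ (ι ∘ φ , ιφ-hom , ι∈U ∘ φ)
  where
  ιφ-hom : ∀ u v → adj F u v ≡ true → adj (complement G) (ι (φ u)) (ι (φ v)) ≡ true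
  ιφ-hom u v uv = trans (sym (complement-induced G ι ι-inj (φ u) (φ v))) (φ-hom u v uv)

independent-within : ∀ {h n k N} (H : Graph h) (G : Graph n) → H -free G → RamseyProp H (K k) N →
  (U : Fin n → Bool) → N ≤ count U →
  Σ (Vec (Fin n) k) λ xs → isIndependent G xs ≡ true × allᵇ U xs ≡ true
independent-within {k = k} H G H-free ramsey U N≤∣U∣ with ramsey-within H (K k) G ramsey U N≤∣U∣
... | inj₁ H⊆G = ⊥-elim (H-free H⊆G)
... | inj₂ (g , g-hom , g∈U) =
  tabulate g , clique-tabulate (complement G) g (λ u v u≢v → g-hom u v (K-adj u≢v)) , allᵇ-tabulate U g g∈U

-- A Ramsey number R(H, K_t) with t ≥ 1 is positive when some graph is H-free: the empty
-- graph contains H only if H is empty (and then H embeds everywhere), and never contains K_t.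
ramsey-positive : ∀ {h n t N} (H : Graph h) (G : Graph n) → H -free G → RamseyProp H (K t) N →
  0 < t → 0 < N
ramsey-positive {N = suc N} H G H-free ramsey 0<t = z<s
ramsey-positive {t = suc t} {N = zero} H G H-free ramsey 0<t with ramsey emptyGraph
  where
  emptyGraph : Graph 0
  emptyGraph = record { adj = λ () ; adj-sym = λ () ; irrefl = λ () }
... | inj₁ (φ , _ , _) = ⊥-elim (H-free (nowhere ∘ φ , (λ {u} _ → nowhere (φ u)) , (λ u _ _ → nowhere (φ u))))
  where
  nowhere : ∀ {A : Set} → Fin 0 → A
  nowhere = ⊥-elim ∘ ¬Fin0
... | inj₂ (φ , _ , _) = ⊥-elim (¬Fin0 (φ zero))

data Side (s t : ℕ) : Fin (s + t) → Set where
  left  : (a : Fin s) → Side s t (a ↑ˡ t)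
  right : (b : Fin t) → Side s t (s ↑ʳ b)

side : ∀ s t (u : Fin (s + t)) → Side s t u
side s t u with splitAt s u | join-splitAt s t u
... | inj₁ a | refl = left a
... | inj₂ b | refl = right b

isLeft-↑ˡ : ∀ s t (a : Fin s) → (toℕ (a ↑ˡ t) <ᵇ s) ≡ true
isLeft-↑ˡ s t a rewrite toℕ-↑ˡ a t = <ᵇ-true (toℕ<n a)

isLeft-↑ʳ : ∀ s t (b : Fin t) → (toℕ (s ↑ʳ b) <ᵇ s) ≡ false
isLeft-↑ʳ s t b rewrite toℕ-↑ʳ s b = <ᵇ-false (m+n≮m s (toℕ b))

induced-Kbip : ∀ {n s t} (G : Graph n) (xs : Vec (Fin n) s) (ys : Vec (Fin n) t) →
  isIndependent G xs ≡ true → isIndependent G ys ≡ true →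
  allᵇ (λ y → allᵇ (adj G y) xs) ys ≡ true → Kbip s t ⊆ᵢ G
induced-Kbip {n} {s} {t} G xs ys ind-xs ind-ys complete = φ , φ-injective , φ-adj
  where
  x : Fin s → Fin n
  x = lookup xs
  y : Fin t → Fin n
  y = lookup ys
  cross : ∀ a b → adj G (y b) (x a) ≡ true
  cross a b = allᵇ-lookup (adj G (y b)) xs (allᵇ-lookup _ ys complete b) a
  x≢y : ∀ a b → x a ≢ y b
  x≢y a b = adjacent⇒distinct G (cross a b) ∘ sym
  φ : Fin (s + t) → Fin n
  φ u = [ x , y ]′ (splitAt s u)
  φ-left : ∀ a → φ (a ↑ˡ t) ≡ x a
  φ-left a = cong [ x , y ]′ (splitAt-↑ˡ s a t)
  φ-right : ∀ b → φ (s ↑ʳ b) ≡ y b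
  φ-right b = cong [ x , y ]′ (splitAt-↑ʳ s t b)
  φ-injective : Injective _≡_ _≡_ φ
  φ-injective {u} {v} φu≡φv with side s t u | side s t v
  ... | left a  | left a′  rewrite φ-left a  | φ-left a′  = cong (_↑ˡ t) (independent-injective G xs ind-xs φu≡φv)
  ... | left a  | right b  rewrite φ-left a  | φ-right b  = ⊥-elim (x≢y a b φu≡φv)
  ... | right b | left a   rewrite φ-right b | φ-left a   = ⊥-elim (x≢y a b (sym φu≡φv))
  ... | right b | right b′ rewrite φ-right b | φ-right b′ = cong (s ↑ʳ_) (independent-injective G ys ind-ys φu≡φv)
  φ-adj : ∀ u v → adj G (φ u) (φ v) ≡ adj (Kbip s t) u v
  φ-adj u v with side s t u | side s t v
  ... | left a  | left a′  rewrite φ-left a  | φ-left a′  | isLeft-↑ˡ s t a | isLeft-↑ˡ s t a′ =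
    independent-nonadjacent G xs ind-xs a a′
  ... | left a  | right b  rewrite φ-left a  | φ-right b  | isLeft-↑ˡ s t a | isLeft-↑ʳ s t b =
    trans (adj-sym G (x a) (y b)) (cross a b)
  ... | right b | left a   rewrite φ-right b | φ-left a   | isLeft-↑ʳ s t b | isLeft-↑ˡ s t a =
    cross a b
  ... | right b | right b′ rewrite φ-right b | φ-right b′ | isLeft-↑ʳ s t b | isLeft-↑ʳ s t b′ =
    independent-nonadjacent G ys ind-ys b b′

commonNeighbours : ∀ {n s} → Graph n → Vec (Fin n) s → Fin n → Bool
commonNeighbours G xs v = allᵇ (adj G v) xs

-- If G is H-free and has no induced K_{s,t}, every independent s-tuple has fewer than
-- R(H, K_t) common neighbours: otherwise they would contain an independent t-tuple.
common-neighbourhood-bound : ∀ {h n s t N} (H : Graph h) (G : Graph n) → H -free G →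
  ¬ (Kbip s t ⊆ᵢ G) → RamseyProp H (K t) N →
  (xs : Vec (Fin n) s) → isIndependent G xs ≡ true → count (commonNeighbours G xs) < N
common-neighbourhood-bound {N = N} H G H-free no-Kbip ramsey xs ind-xs
  with N ≤? count (commonNeighbours G xs)
... | no  N≰∣C∣ = ≰⇒> N≰∣C∣
... | yes N≤∣C∣ with independent-within H G H-free ramsey (commonNeighbours G xs) N≤∣C∣
...   | ys , ind-ys , ys⊆C = ⊥-elim (no-Kbip (induced-Kbip G xs ys ind-xs ind-ys ys⊆C))

indepCount : ∀ {n} → Graph n → ℕ → (Fin n → Bool) → ℕ
indepCount G s U = ∑ᵗ s (λ xs → ind (isIndependent G xs ∧ allᵇ U xs))

-- For a fixed tuple xs: the vertices w ∈ U such that xs is independent inside U ─ w are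
-- exactly the |U| - s vertices of U outside xs (when xs is independent inside U).
deletion-per-tuple : ∀ {n s} (G : Graph n) (U : Fin n → Bool) (xs : Vec (Fin n) s) →
  ∑[ w < n ] (ind (U w) * ind (isIndependent G xs ∧ allᵇ (U ─ w) xs)) + s * ind (isIndependent G xs ∧ allᵇ U xs)
    ≡ count U * ind (isIndependent G xs ∧ allᵇ U xs)
deletion-per-tuple {n} {s} G U xs =
  trans (cong (_+ s * I) (trans (sum-cong-≗ term) (sym (*-distribˡ-sum I (λ w → ind (U w ∧ w ∉ᵇ xs))))))
        (by-cases (isIndependent G xs) (allᵇ U xs) refl refl)
  where
  I : ℕ
  I = ind (isIndependent G xs ∧ allᵇ U xs)
  C : ℕ
  C = count (λ w → U w ∧ w ∉ᵇ xs)
  shuffle : ∀ u g a w∉ → ind u * ind (g ∧ (a ∧ w∉)) ≡ ind (g ∧ a) * ind (u ∧ w∉)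
  shuffle true  true  true  w∉ = trans (+-identityʳ _) (sym (+-identityʳ _))
  shuffle true  true  false w∉ = refl
  shuffle true  false a     w∉ = refl
  shuffle false true  true  w∉ = refl
  shuffle false true  false w∉ = refl
  shuffle false false a     w∉ = refl
  term : ∀ w → ind (U w) * ind (isIndependent G xs ∧ allᵇ (U ─ w) xs) ≡ I * ind (U w ∧ w ∉ᵇ xs)
  term w = trans (cong (λ b → ind (U w) * ind (isIndependent G xs ∧ b)) (allᵇ-─ U w xs))
                 (shuffle (U w) (isIndependent G xs) (allᵇ U xs) (w ∉ᵇ xs))
  by-cases : ∀ g a → isIndependent G xs ≡ g → allᵇ U xs ≡ a →
    ind (g ∧ a) * C + s * ind (g ∧ a) ≡ count U * ind (g ∧ a)
  by-cases true  true  ind-xs xs⊆U = begin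
    1 * C + s * 1   ≡⟨ cong₂ _+_ (*-identityˡ C) (*-identityʳ s) ⟩
    C + s           ≡⟨ count-outside (complement G) xs U ind-xs xs⊆U ⟩
    count U         ≡⟨ *-identityʳ (count U) ⟨
    count U * 1     ∎
    where open ≡-Reasoning
  by-cases true  false _ _ = trans (*-zeroʳ s) (sym (*-zeroʳ (count U)))
  by-cases false a     _ _ = trans (*-zeroʳ s) (sym (*-zeroʳ (count U)))

-- Double counting pairs (w, xs) with w ∈ U and xs independent inside U ─ w:
-- ∑_{w ∈ U} #indep(U ─ w) = (|U| - s) · #indep(U).
deletion : ∀ {n} (G : Graph n) s (U : Fin n → Bool) →
  ∑[ w < n ] (ind (U w) * indepCount G s (U ─ w)) + s * indepCount G s U ≡ count U * indepCount G s U
deletion {n} G s U = begin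
  ∑[ w < n ] (ind (U w) * indepCount G s (U ─ w)) + s * indepCount G s U
    ≡⟨ cong₂ _+_ (trans (sum-cong-≗ (λ w → ∑ᵗ-distribˡ s (ind (U w)) _)) (∑-∑ᵗ-comm n s _))
                 (∑ᵗ-distribˡ s s _) ⟩
  ∑ᵗ s (λ xs → ∑[ w < n ] (ind (U w) * indIn (U ─ w) xs)) + ∑ᵗ s (λ xs → s * indIn U xs)
    ≡⟨ ∑ᵗ-distrib-+ s _ _ ⟨
  ∑ᵗ s (λ xs → ∑[ w < n ] (ind (U w) * indIn (U ─ w) xs) + s * indIn U xs)
    ≡⟨ ∑ᵗ-cong s (deletion-per-tuple G U) ⟩
  ∑ᵗ s (λ xs → count U * indIn U xs)
    ≡⟨ ∑ᵗ-distribˡ s (count U) _ ⟨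
  count U * indepCount G s U ∎
  where
  open ≡-Reasoning
  indIn : (Fin n → Bool) → Vec (Fin n) s → ℕ
  indIn V xs = ind (isIndependent G xs ∧ allᵇ V xs)

supersaturation-step : ∀ {n} (G : Graph n) s R (U : Fin n → Bool) m → count U ≡ suc m → s ≤ m →
  (∀ w → U w ≡ true → m ^ s ≤ R ^ s * indepCount G s (U ─ w)) →
  suc m ^ s ≤ R ^ s * indepCount G s U
supersaturation-step {n} G s R U m ∣U∣≡p s≤m hyp =
  *-cancelˡ-≤ (p ∸ s) {{>-nonZero (m<n⇒0<n∸m (s≤s s≤m))}} (begin
    (p ∸ s) * p ^ s                  ≤⟨ bernoulli p s ⟩
    p * m ^ s                        ≡⟨ cong (_* m ^ s) ∣U∣≡p ⟨
    count U * m ^ s                  ≡⟨ *-distribʳ-sum (m ^ s) (ind ∘ U) ⟩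
    ∑[ w < n ] (ind (U w) * m ^ s)   ≤⟨ ∑-mono per-vertex ⟩
    ∑[ w < n ] (R ^ s * D w)         ≡⟨ *-distribˡ-sum (R ^ s) D ⟨
    R ^ s * sum D                    ≡⟨ cong (R ^ s *_) ∑D≡[p∸s]T ⟩
    R ^ s * ((p ∸ s) * T)            ≡⟨ x*[y*z]≡y*[x*z] (R ^ s) (p ∸ s) T ⟩
    (p ∸ s) * (R ^ s * T)            ∎)
  where
  open ≤-Reasoning
  p : ℕ
  p = suc m
  T : ℕ
  T = indepCount G s U
  D : Fin n → ℕ
  D w = ind (U w) * indepCount G s (U ─ w)
  per-vertex : ∀ w → ind (U w) * m ^ s ≤ R ^ s * D w
  per-vertex w with U w in w∈U
  ... | false = z≤n
  ... | true  = subst₂ _≤_ (sym (+-identityʳ _)) (cong (R ^ s *_) (sym (+-identityʳ _))) (hyp w w∈U)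
  ∑D≡[p∸s]T : sum D ≡ (p ∸ s) * T
  ∑D≡[p∸s]T = begin-equality
    sum D                    ≡⟨ m+n∸n≡m (sum D) (s * T) ⟨
    sum D + s * T ∸ s * T    ≡⟨ cong (_∸ s * T) (trans (deletion G s U) (cong (_* T) ∣U∣≡p)) ⟩
    p * T ∸ s * T            ≡⟨ *-distribʳ-∸ T p s ⟨
    (p ∸ s) * T              ∎

supersaturation : ∀ {h n} (H : Graph h) (G : Graph n) → H -free G → ∀ s R → RamseyProp H (K s) R →
  ∀ k (U : Fin n → Bool) → count U ≡ R + k → (R + k) ^ s ≤ R ^ s * indepCount G s U
supersaturation H G H-free s R ramsey zero U ∣U∣≡R = begin
  (R + 0) ^ s                ≡⟨ cong (_^ s) (+-identityʳ R) ⟩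
  R ^ s                      ≡⟨ *-identityʳ (R ^ s) ⟨
  R ^ s * 1                  ≤⟨ *-monoʳ-≤ (R ^ s) (indepCount-positive U R≤∣U∣) ⟩
  R ^ s * indepCount G s U   ∎
  where
  open ≤-Reasoning
  R≤∣U∣ : R ≤ count U
  R≤∣U∣ = ≤-reflexive (sym (trans ∣U∣≡R (+-identityʳ R)))
  indepCount-positive : ∀ V → R ≤ count V → 1 ≤ indepCount G s V
  indepCount-positive V R≤∣V∣ with independent-within H G H-free ramsey V R≤∣V∣
  ... | xs , ind-xs , xs⊆V = ≤-trans (≤-reflexive (cong₂ (λ a b → ind (a ∧ b)) (sym ind-xs) (sym xs⊆V)))
                                      (term≤∑ᵗ s _ xs)
supersaturation H G H-free s R ramsey (suc k) U ∣U∣≡R+1+k =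
  subst (λ x → x ^ s ≤ R ^ s * indepCount G s U) (sym (+-suc R k))
    (supersaturation-step G s R U (R + k) ∣U∣≡1+m s≤m
      (λ w w∈U → supersaturation H G H-free s R ramsey k (U ─ w) (∣U─w∣≡m w w∈U)))
  where
  ∣U∣≡1+m : count U ≡ suc (R + k)
  ∣U∣≡1+m = trans ∣U∣≡R+1+k (+-suc R k)
  ∣U─w∣≡m : ∀ w → U w ≡ true → count (U ─ w) ≡ R + k
  ∣U─w∣≡m w w∈U = +-cancelʳ-≡ 1 _ _ (trans (count-─ U w w∈U) (trans ∣U∣≡1+m (+-comm 1 (R + k))))
  -- U ─ w still has at least R vertices, so it contains an independent s-tuple.
  s≤m : s ≤ R + k
  s≤m with element U (R + k) ∣U∣≡1+m
  ... | w , w∈U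
    with independent-within H G H-free ramsey (U ─ w) (≤-trans (m≤m+n R k) (≤-reflexive (sym (∣U─w∣≡m w w∈U))))
  ...   | xs , ind-xs , xs⊆U─w = subst (s ≤_) ∣U─w∣≡s+rest (m≤n+m s _)
    where
    ∣U─w∣≡s+rest : count (λ z → (U ─ w) z ∧ z ∉ᵇ xs) + s ≡ R + k
    ∣U─w∣≡s+rest = trans (count-outside (complement G) xs (U ─ w) ind-xs xs⊆U─w) (∣U─w∣≡m w w∈U)

m≤m^[1+k] : ∀ m k → m ≤ m ^ suc k
m≤m^[1+k] zero    k = z≤n
m≤m^[1+k] (suc m) k = m≤m*n (suc m) (suc m ^ k) {{m^n≢0 (suc m) k}}

-- Degree bound from supersaturation in the neighbourhood N(v); the + 1 covers deg(v) < R.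
degree-power-bound : ∀ {h n} (H : Graph h) (G : Graph n) → H -free G → ∀ s R → RamseyProp H (K s) R →
  ∀ v → degree G v ^ s ≤ R ^ s * (indepCount G s (adj G v) + 1)
degree-power-bound H G H-free s R ramsey v with R ≤? degree G v
... | yes R≤d = ≤-trans
  (subst (λ x → x ^ s ≤ R ^ s * indepCount G s (adj G v)) (m+[n∸m]≡n R≤d)
    (supersaturation H G H-free s R ramsey (degree G v ∸ R) (adj G v) (sym (m+[n∸m]≡n R≤d))))
  (*-monoʳ-≤ (R ^ s) (m≤m+n _ 1))
... | no  R≰d = ≤-trans (^-monoˡ-≤ s (<⇒≤ (≰⇒> R≰d)))
  (subst (_≤ R ^ s * (indepCount G s (adj G v) + 1)) (*-identityʳ _) (*-monoʳ-≤ (R ^ s) (m≤n+m 1 _)))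

-- Summing over v counts pairs (v, xs) with xs an independent s-tuple in N(v), i.e. v a common
-- neighbour of xs; each independent xs has fewer than R(H, K_t) common neighbours.
neighbourhood-count-bound : ∀ {h n s t N} (H : Graph h) (G : Graph n) → H -free G →
  ¬ (Kbip s t ⊆ᵢ G) → RamseyProp H (K t) N →
  ∑[ v < n ] indepCount G s (adj G v) ≤ n ^ s * (N ∸ 1)
neighbourhood-count-bound {n = n} {s} {N = N} H G H-free no-Kbip ramsey = begin
  ∑[ v < n ] indepCount G s (adj G v)                                   ≡⟨ ∑-∑ᵗ-comm n s _ ⟩
  ∑ᵗ s (λ xs → ∑[ v < n ] ind (isIndependent G xs ∧ allᵇ (adj G v) xs)) ≤⟨ ∑ᵗ-mono s per-tuple ⟩
  ∑ᵗ s (λ _ → N ∸ 1)                                                    ≡⟨ ∑ᵗ-const s (N ∸ 1) ⟩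
  n ^ s * (N ∸ 1)                                                       ∎
  where
  open ≤-Reasoning
  per-tuple : ∀ xs → ∑[ v < n ] ind (isIndependent G xs ∧ allᵇ (adj G v) xs) ≤ N ∸ 1
  per-tuple xs with isIndependent G xs in ind-xs
  ... | false = ≤-trans (≤-reflexive (trans (∑-const n 0) (*-zeroʳ n))) z≤n
  ... | true  = <⇒≤pred (common-neighbourhood-bound H G H-free no-Kbip ramsey xs ind-xs)

degree-power-sum : ∀ {h n} (H : Graph h) (G : Graph n) → H -free G → ∀ k t Rt Rs →
  ¬ (Kbip (suc k) t ⊆ᵢ G) → 0 < t → RamseyProp H (K t) Rt → RamseyProp H (K (suc k)) Rs →
  ∑[ v < n ] (degree G v ^ suc k) ≤ Rs ^ suc k * (Rt * n ^ suc k)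
degree-power-sum {n = n} H G H-free k t Rt Rs no-Kbip 0<t ramsey-t ramsey-s = begin
  ∑[ v < n ] (degree G v ^ s)
    ≤⟨ ∑-mono (degree-power-bound H G H-free s Rs ramsey-s) ⟩
  ∑[ v < n ] (Rs ^ s * (T v + 1))
    ≡⟨ *-distribˡ-sum (Rs ^ s) (λ v → T v + 1) ⟨
  Rs ^ s * ∑[ v < n ] (T v + 1)
    ≡⟨ cong (Rs ^ s *_) (trans (∑-distrib-+ T (λ _ → 1)) (cong (sum T +_) (trans (∑-const n 1) (*-identityʳ n)))) ⟩
  Rs ^ s * (sum T + n)
    ≤⟨ *-monoʳ-≤ (Rs ^ s) (+-mono-≤ (neighbourhood-count-bound H G H-free no-Kbip ramsey-t) (m≤m^[1+k] n k)) ⟩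
  Rs ^ s * (n ^ s * (Rt ∸ 1) + n ^ s)
    ≡⟨ cong (Rs ^ s *_) ∑≡Rt*nˢ ⟩
  Rs ^ s * (Rt * n ^ s) ∎
  where
  open ≤-Reasoning
  s : ℕ
  s = suc k
  T : Fin n → ℕ
  T v = indepCount G s (adj G v)
  ∑≡Rt*nˢ : n ^ s * (Rt ∸ 1) + n ^ s ≡ Rt * n ^ s
  ∑≡Rt*nˢ = begin-equality
    n ^ s * (Rt ∸ 1) + n ^ s       ≡⟨ cong (n ^ s * (Rt ∸ 1) +_) (*-identityʳ (n ^ s)) ⟨
    n ^ s * (Rt ∸ 1) + n ^ s * 1   ≡⟨ *-distribˡ-+ (n ^ s) (Rt ∸ 1) 1 ⟨
    n ^ s * (Rt ∸ 1 + 1)           ≡⟨ cong (n ^ s *_) (m∸n+n≡m (ramsey-positive H G H-free ramsey-t 0<t)) ⟩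
    n ^ s * Rt                     ≡⟨ *-comm (n ^ s) Rt ⟩
    Rt * n ^ s                     ∎

corollary1 : {h : ℕ} (H : Graph h) (s t : ℕ) → 2 ≤ s → s ≤ t →
    (Rt Rs : ℕ) → IsRamseyNumber H (K t) Rt → IsRamseyNumber H (K s) Rs →
    (n : ℕ) (G : Graph n) → H -free G → ¬ (Kbip s t ⊆ᵢ G) →
    (2 * edges G) ^ s ≤ (Rt ^ 2) * (Rs ^ s) * (n ^ (2 * s ∸ 1))
corollary1 H s@(suc k) t 2≤s s≤t Rt Rs (ramsey-t , _) (ramsey-s , _) n G H-free no-Kbip = begin
  (2 * edges G) ^ s
    ≡⟨ cong (_^ s) (handshake G) ⟨
  sum (degree G) ^ s
    ≤⟨ power-mean n (degree G) k ⟩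
  n ^ k * ∑[ v < n ] (degree G v ^ s)
    ≤⟨ *-monoʳ-≤ (n ^ k) (degree-power-sum H G H-free k t Rt Rs no-Kbip 0<t ramsey-t ramsey-s) ⟩
  n ^ k * (Rs ^ s * (Rt * n ^ s))
    ≡⟨ solve 4 (λ a b c d → a :* (b :* (c :* d)) := c :* b :* (a :* d)) refl (n ^ k) (Rs ^ s) Rt (n ^ s) ⟩
  Rt * Rs ^ s * (n ^ k * n ^ s)
    ≡⟨ cong (Rt * Rs ^ s *_) (^-distribˡ-+-* n k s) ⟨
  Rt * Rs ^ s * n ^ (k + s)
    ≤⟨ *-monoˡ-≤ (n ^ (k + s)) (*-monoˡ-≤ (Rs ^ s) (m≤m^[1+k] Rt 1)) ⟩
  Rt ^ 2 * Rs ^ s * n ^ (k + s)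
    ≡⟨ cong (λ e → Rt ^ 2 * Rs ^ s * n ^ (k + e)) (+-identityʳ s) ⟨
  Rt ^ 2 * Rs ^ s * n ^ (2 * s ∸ 1) ∎
  where
  open ≤-Reasoning
  0<t : 0 < t
  0<t = <-≤-trans z<s (≤-trans 2≤s s≤t)
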